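{- Run the following algorithm on a properly vertex-colored digraph $(\vec G=(V,E),\sigma)$ with $V\neq\emptyset$, with an arbitrary rule for choosing partitions: initialize $\vec G^*\leftarrow\vec G$; call $\mathrm{Edit}(V)$, where $\mathrm{Edit}(V')$ does the following: if $|V'|>1$, choose a partition $\mathscr V$ of $V'$ with $|\mathscr V|\ge 2$, replace $\vec G^*$ by $\vec G^*\triangle U(\vec G^*[V'],\mathscr V)$ (computed for the current $\vec G^*$ at the start of this step), and then call $\mathrm{Edit}(V_i)$ for each $V_i\in\mathscr V$; if $|V'|=1$, do nothing. Let $E^*$ be the arc set of $\vec G^*$ at termination. Then the edit cost $|E\triangle E^*|$ equals the sum, over all recursion steps with $|V'|>1$, of the UR-costs $c(\vec G^*[V'],\mathscr V)$, where $\vec G^*$ denotes the current graph at the start of the respective step.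
   Context: A digraph $\vec G=(V,E)$ has a finite vertex set and arc set $E\subseteq (V\times V)\setminus\{(v,v)\mid v\in V\}$; $\vec G\triangle F=(V,E\triangle F)$; $\vec G[W]$ is the induced subgraph on $W$, colored by $\sigma_{|W}$. A vertex coloring $\sigma$ is proper if adjacent vertices have distinct colors. All rooted trees are phylogenetic (every non-leaf vertex has at least two children); $L(T)$ is the leaf set, $\rho_T$ the root, $T(v)$ the subtree rooted at $v$, $\mathrm{child}_T(v)$ the children of $v$; $u\preceq_T v$ means $v$ lies on the path from $u$ to the root; $\mathrm{lca}_T$ is the last common ancestor. For a tree $T$ with leaf coloring $\sigma$, a leaf $y$ is a best match of a leaf $x$ if $\sigma(x)\ne\sigma(y)$ and $\mathrm{lca}_T(x,y)\preceq_T\mathrm{lca}_T(x,y')$ for all leaves $y'$ with $\sigma(y')=\sigma(y)$; the best match graph $\vec G(T,\sigma)$ has vertex set $L(T)$ and arcs $(x,y)$ whenever $y$ is a best match of $x$. For a colored digraph $(\vec H=(W,E_H),\tau)$ and tree $T$ with $L(T)=W$, $U(\vec H,T)=E_H\triangle E(\vec G(T,\tau))$. For a partition $\mathscr W$ of $W$ with $|\mathscr W|\ge 2$, $\mathscr T(\mathscr W)$ is the set of phylogenetic trees $T$ with $L(T)=W$ and $\{L(T(v))\mid v\in\mathrm{child}_T(\rho_T)\}=\mathscr W$, $U(\vec H,\mathscr W)=\bigcap_{T\in\mathscr T(\mathscr W)}U(\vec H,T)$, and the UR-cost is $c(\vec H,\mathscr W)=|U(\vec H,\mathscr W)|$. 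-}

module Defs where

open import Data.Nat using (ℕ; zero; suc; _+_; _≤_; _<_)
open import Data.Bool using (Bool; true; false; not)
open import Data.Fin using (Fin)
open import Data.Fin.Subset as S using (Subset; _∩_; ⋃; ∣_∣; Nonempty; Empty)
open import Data.List using (List; []; _∷_; length)
open import Data.List.Relation.Unary.All using (All)
open import Data.List.Relation.Unary.AllPairs using (AllPairs)
open import Data.List.Relation.Unary.Unique.Propositional using (Unique)
open import Data.List.Membership.Propositional using () renaming (_∈_ to _∈ₗ_)
open import Data.Product using (Σ; Σ-syntax; ∃; ∃-syntax; _×_; _,_)
open import Data.Sum using (_⊎_)
open import Data.Empty using (⊥)
open import Relation.Nullary using (¬_)
open import Relation.Binary.PropositionalEquality using (_≡_; _≢_)
open import Function.Bundles using (_⇔_)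

Digraph : ℕ → Set
Digraph n = Fin n → Fin n → Bool

Coloring : ℕ → Set
Coloring n = Fin n → ℕ

Loopless : ∀ {n} → Digraph n → Set
Loopless G = ∀ x → G x x ≡ false

Proper : ∀ {n} → Digraph n → Coloring n → Set
Proper G σ = ∀ x y → G x y ≡ true → σ x ≢ σ y

Card : ∀ {n} → (Fin n → Fin n → Set) → ℕ → Set
Card {n} P k = Σ[ l ∈ List (Fin n × Fin n) ]
  (Unique l × length l ≡ k × (∀ x y → ((x , y) ∈ₗ l) ⇔ P x y))

data Tree (n : ℕ) : Set where
  leaf : Fin n → Tree n
  node : List (Tree n) → Tree n

data Phylo {n : ℕ} : Tree n → Set where
  leaf : ∀ x → Phylo (leaf x)
  node : ∀ {ts} → 2 ≤ length ts → All Phylo ts → Phylo (node ts)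

mutual
  leaves : ∀ {n} → Tree n → List (Fin n)
  leaves (leaf x)  = x ∷ []
  leaves (node ts) = leavesL ts

  leavesL : ∀ {n} → List (Tree n) → List (Fin n)
  leavesL []       = []
  leavesL (t ∷ ts) = leaves t Data.List.++ leavesL ts

LeafSet : ∀ {n} → Tree n → Subset n → Set
LeafSet T W = ∀ x → (x ∈ₗ leaves T) ⇔ (x S.∈ W)

-- Vertices of a tree are addressed by paths from the root (List ℕ, the
-- i-th entry = index of the child taken).  Addr T x p : leaf x sits at p.
mutual
  data Addr {n : ℕ} : Tree n → Fin n → List ℕ → Set where
    here  : ∀ {x} → Addr (leaf x) x []
    there : ∀ {ts x p} → AddrL ts x p → Addr (node ts) x p

  data AddrL {n : ℕ} : List (Tree n) → Fin n → List ℕ → Set where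
    hd : ∀ {t ts x p} → Addr t x p → AddrL (t ∷ ts) x (0 ∷ p)
    tl : ∀ {t ts x i p} → AddrL ts x (i ∷ p) → AddrL (t ∷ ts) x (suc i ∷ p)

-- address of lca of two vertices = longest common prefix of their addresses
lcp : List ℕ → List ℕ → List ℕ
lcp (a ∷ as) (b ∷ bs) with a Data.Nat.≟ b
... | Relation.Nullary.yes _ = a ∷ lcp as bs
... | Relation.Nullary.no  _ = []
lcp _ _ = []

data Prefix : List ℕ → List ℕ → Set where
  []  : ∀ {q} → Prefix [] q
  _∷_ : ∀ a {p q} → Prefix p q → Prefix (a ∷ p) (a ∷ q)

-- u ⪯_T v  (v lies on the path from u to the root), for vertices given
-- by their addresses: v's address is a prefix of u's address
_⪯_ : List ℕ → List ℕ → Set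
u ⪯ v = Prefix v u

BestMatch : ∀ {n} → Coloring n → Tree n → Fin n → Fin n → Set
BestMatch σ T x y =
  σ x ≢ σ y ×
  Σ[ px ∈ List ℕ ] Σ[ py ∈ List ℕ ] (Addr T x px × Addr T y py ×
    (∀ y' py' → σ y' ≡ σ y → Addr T y' py' → lcp px py ⪯ lcp px py'))

BMGArc : ∀ {n} → Coloring n → Tree n → Fin n → Fin n → Set
BMGArc σ T x y = (x ∈ₗ leaves T) × (y ∈ₗ leaves T) × BestMatch σ T x y

IsPartition : ∀ {n} → Subset n → List (Subset n) → Set
IsPartition V' 𝒱 =
  All Nonempty 𝒱 × AllPairs (λ A B → Empty (A ∩ B)) 𝒱 × ⋃ 𝒱 ≡ V'

RootBlocks : ∀ {n} → Tree n → List (Subset n) → Set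
RootBlocks     (leaf _)  𝒲 = ⊥
RootBlocks {n} (node ts) 𝒲 =
  (∀ t → t ∈ₗ ts → Σ[ B ∈ Subset n ] (B ∈ₗ 𝒲 × LeafSet t B)) ×
  (∀ B → B ∈ₗ 𝒲 → Σ[ t ∈ Tree n ] (t ∈ₗ ts × LeafSet t B))

InTrees : ∀ {n} → Subset n → List (Subset n) → Tree n → Set
InTrees W 𝒲 T = Phylo T × Unique (leaves T) × LeafSet T W × RootBlocks T 𝒲

Xor : Bool → Set → Set
Xor b P = (b ≡ true × ¬ P) ⊎ (b ≡ false × P)

InUT : ∀ {n} → Coloring n → Digraph n → Subset n → Tree n → Fin n → Fin n → Set
InUT σ G W T x y = x S.∈ W × y S.∈ W × Xor (G x y) (BMGArc σ T x y)

InU : ∀ {n} → Coloring n → Digraph n → Subset n → List (Subset n) → Fin n → Fin n → Set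
InU σ G W 𝒲 x y =
  x S.∈ W × y S.∈ W × (∀ T → InTrees W 𝒲 T → InUT σ G W T x y)

SymDiffWith : ∀ {n} → Digraph n → (Fin n → Fin n → Set) → Digraph n → Set
SymDiffWith G F G' =
  ∀ x y → (F x y → G' x y ≡ not (G x y)) × (¬ F x y → G' x y ≡ G x y)

-- Run σ G V' G' k : calling Edit(V') with current graph G* = G terminates
-- with current graph G', and k is the sum of the UR-costs
-- c(G*[V''], 𝒱'') over all recursion steps (with |V''| > 1) of this call.

mutual
  data Run {n : ℕ} (σ : Coloring n) : Digraph n → Subset n → Digraph n → ℕ → Set where
    single : ∀ {G V'} → ∣ V' ∣ ≡ 1 → Run σ G V' G 0
    step   : ∀ {G V' 𝒱 c G₁ G₂ k} →
             1 < ∣ V' ∣ →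
             IsPartition V' 𝒱 → 2 ≤ length 𝒱 →
             Card (InU σ G V' 𝒱) c →
             SymDiffWith G (InU σ G V' 𝒱) G₁ →
             RunAll σ G₁ 𝒱 G₂ k →
             Run σ G V' G₂ (c + k)

  data RunAll {n : ℕ} (σ : Coloring n) : Digraph n → List (Subset n) → Digraph n → ℕ → Set where
    []  : ∀ {G} → RunAll σ G [] G 0
    _∷_ : ∀ {G G₁ G₂ B 𝒱 k k'} → Run σ G B G₁ k → RunAll σ G₁ 𝒱 G₂ k' →
          RunAll σ G (B ∷ 𝒱) G₂ (k + k')

-- An arc (x, y) edited at a step Edit(V') with partition 𝒱 lies in U(G*[V'], T) for
-- every T ∈ 𝒯(𝒱), so after the edit its status agrees with G(T, σ) for all such T.
-- The best match graph of a root subtree is the restriction of G(T, σ), and every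
-- tree on a block B ∈ 𝒱 is a root subtree of some T ∈ 𝒯(𝒱); hence the edited arc
-- agrees with every tree on the block containing x and y, which keeps it out of all
-- later U-sets, while arcs between different blocks are never touched again.  Each
-- arc is therefore edited at most once, and the edit cost is the sum of the UR-costs.
module Submission where

open import Defs
open import Data.Nat using (ℕ; _≤_)
open import Data.Fin.Subset using (⊤)
open import Relation.Binary.PropositionalEquality using (_≢_)

open import Data.Nat using (suc; _+_; s≤s; z≤n; _≟_)
open import Data.Bool using (Bool; true; not)
open import Data.Bool.Properties using (not-¬) renaming (_≟_ to _≟ᵇ_)
open import Data.Fin using (Fin) renaming (_≟_ to _≟ᶠ_)
open import Data.Fin.Subset using (Subset; _∈_; _∩_; ⋃; Nonempty; Empty)
open import Data.Fin.Subset.Properties using (_∈?_; ∉⊥; x∈p∪q⁺; x∈p∪q⁻; x∈p∩q⁺)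
open import Data.List using (List; []; _∷_; _++_; length; map; filter; allFin)
open import Data.List.Properties using (length-++)
open import Data.List.Relation.Unary.All using (All; []; _∷_)
import Data.List.Relation.Unary.All as All
import Data.List.Relation.Unary.All.Properties as All
open import Data.List.Relation.Unary.Any using (here; there)
open import Data.List.Relation.Unary.AllPairs using (AllPairs; []; _∷_)
open import Data.List.Relation.Unary.Unique.Propositional using (Unique)
import Data.List.Relation.Unary.Unique.Propositional.Properties as Unique
open import Data.List.Relation.Binary.Disjoint.Propositional using (Disjoint)
open import Data.List.Relation.Binary.Pointwise using (Pointwise; []; _∷_; Pointwise-length)
open import Data.List.Membership.Propositional using () renaming (_∈_ to _∈ₗ_)
open import Data.List.Membership.Propositional.Properties
  using (∈-++⁺ˡ; ∈-++⁺ʳ; ∈-++⁻; ∈-filter⁺; ∈-filter⁻; ∈-allFin)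
import Data.List.Membership.DecPropositional as DecMembership
open import Data.Product using (Σ-syntax; ∃; ∃₂; _×_; _,_; proj₁; proj₂; uncurry)
open import Data.Product.Properties using (≡-dec)
open import Data.Sum using (_⊎_; inj₁; inj₂; [_,_]′)
import Data.Sum as Sum
open import Relation.Nullary using (¬_; Dec; yes; no; contradiction)
open import Relation.Nullary.Decidable using (decidable-stable)
import Relation.Nullary.Decidable as Dec
open import Relation.Binary.PropositionalEquality
  using (_≡_; refl; sym; trans; cong; cong₂; subst; subst₂)
open import Function.Base using (_∘_)
open import Function.Bundles using (_⇔_; mk⇔; Equivalence)
open import Function.Construct.Composition using (_⇔-∘_)
open import Function.Construct.Symmetry using (⇔-sym)
open Equivalence using (to; from)

unique-++⁻ : ∀ {A : Set} (xs : List A) {ys} →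
  Unique (xs ++ ys) → Unique xs × Unique ys × Disjoint xs ys
unique-++⁻ []       u         = [] , u , λ { (() , _) }
unique-++⁻ (x ∷ xs) (x∉ ∷ u) with unique-++⁻ xs u
... | u-xs , u-ys , disjoint = All.++⁻ˡ xs x∉ ∷ u-xs , u-ys , λ where
  (here refl , x∈ys)  → All.lookup (All.++⁻ʳ xs x∉) x∈ys refl
  (there v∈xs , v∈ys) → disjoint (v∈xs , v∈ys)

lcp-cons : ∀ i a b → lcp (i ∷ a) (i ∷ b) ≡ i ∷ lcp a b
lcp-cons i a b with i ≟ i
... | yes _   = refl
... | no  i≢i = contradiction refl i≢i

lcp-diverge : ∀ i a p → (∃ λ c → p ≡ i ∷ c) ⊎ lcp (i ∷ a) p ≡ []
lcp-diverge i a []      = inj₂ refl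
lcp-diverge i a (j ∷ p) with i ≟ j
... | yes refl = inj₁ (p , refl)
... | no  _    = inj₂ refl

xor-not : ∀ {b P} → Xor b P → not b ≡ true ⇔ P
xor-not (inj₁ (refl , ¬p)) = mk⇔ (λ ()) (λ p → contradiction p ¬p)
xor-not (inj₂ (refl , p))  = mk⇔ (λ _ → p) (λ _ → refl)

xor-¬⇔ : ∀ {b P} → Xor b P → ¬ (b ≡ true ⇔ P)
xor-¬⇔ (inj₁ (refl , ¬p)) b⇔P = ¬p (to b⇔P refl)
xor-¬⇔ (inj₂ (refl , p))  b⇔P with () ← from b⇔P p

module _ {n : ℕ} where

  mutual
    addr⇒∈ : ∀ {t : Tree n} {x p} → Addr t x p → x ∈ₗ leaves t
    addr⇒∈ here      = here refl
    addr⇒∈ (there a) = addrL⇒∈ a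

    addrL⇒∈ : ∀ {ts : List (Tree n)} {x p} → AddrL ts x p → x ∈ₗ leavesL ts
    addrL⇒∈ (hd a)       = ∈-++⁺ˡ (addr⇒∈ a)
    addrL⇒∈ (tl {t} a)   = ∈-++⁺ʳ (leaves t) (addrL⇒∈ a)

  mutual
    ∈⇒addr : ∀ (t : Tree n) {x} → x ∈ₗ leaves t → ∃ (Addr t x)
    ∈⇒addr (leaf _)  (here refl) = [] , here
    ∈⇒addr (node ts) x∈ts with ∈⇒addrL ts x∈ts
    ... | i , p , a = i ∷ p , there a

    ∈⇒addrL : ∀ (ts : List (Tree n)) {x} → x ∈ₗ leavesL ts → ∃₂ λ i p → AddrL ts x (i ∷ p)
    ∈⇒addrL (t ∷ ts) x∈ with ∈-++⁻ (leaves t) x∈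
    ... | inj₁ x∈t  = let p , a = ∈⇒addr t x∈t in 0 , p , hd a
    ... | inj₂ x∈ts = let i , p , a = ∈⇒addrL ts x∈ts in suc i , p , tl a

  mutual
    addr-unique : ∀ {t : Tree n} {x p q} → Unique (leaves t) → Addr t x p → Addr t x q → p ≡ q
    addr-unique u here      here      = refl
    addr-unique u (there a) (there b) = addrL-unique u a b

    addrL-unique : ∀ {ts : List (Tree n)} {x p q} → Unique (leavesL ts) → AddrL ts x p → AddrL ts x q → p ≡ q
    addrL-unique {t ∷ _} u a b with unique-++⁻ (leaves t) u
    addrL-unique u (hd a) (hd b) | u-t , _ , _ = cong (0 ∷_) (addr-unique u-t a b)
    addrL-unique u (tl a) (tl b) | _ , u-ts , _ with addrL-unique u-ts a b
    ... | refl = refl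
    addrL-unique u (hd a) (tl b) | _ , _ , disjoint = contradiction (addr⇒∈ a , addrL⇒∈ b) disjoint
    addrL-unique u (tl a) (hd b) | _ , _ , disjoint = contradiction (addr⇒∈ b , addrL⇒∈ a) disjoint

  position : ∀ {S : Tree n} {ts} → S ∈ₗ ts → ℕ
  position (here _)     = 0
  position (there S∈ts) = suc (position S∈ts)

  child-addr⁺ : ∀ {ts S z c} (S∈ts : S ∈ₗ ts) → Addr S z c → AddrL ts z (position S∈ts ∷ c)
  child-addr⁺ (here refl)  a = hd a
  child-addr⁺ (there S∈ts) a = tl (child-addr⁺ S∈ts a)

  child-addr⁻ : ∀ {ts S z c} (S∈ts : S ∈ₗ ts) → AddrL ts z (position S∈ts ∷ c) → Addr S z c
  child-addr⁻ (here refl)  (hd a) = a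
  child-addr⁻ (there S∈ts) (tl a) = child-addr⁻ S∈ts a

  bmgArc-child : ∀ (σ : Coloring n) {ts S x y} → S ∈ₗ ts → Unique (leavesL ts) →
    x ∈ₗ leaves S → y ∈ₗ leaves S → BMGArc σ (node ts) x y ⇔ BMGArc σ S x y
  bmgArc-child σ {ts} {S} {x} {y} S∈ts u x∈S y∈S = mk⇔ restrict extend
    where
    i : ℕ
    i = position S∈ts

    lift : ∀ {z c} → Addr S z c → Addr (node ts) z (i ∷ c)
    lift a = there (child-addr⁺ S∈ts a)

    restrict : BMGArc σ (node ts) x y → BMGArc σ S x y
    restrict (_ , _ , σx≢σy , _ , _ , ax , ay , best)
      with a , aS ← ∈⇒addr S x∈S | b , bS ← ∈⇒addr S y∈S
      with refl ← addr-unique u ax (lift aS) | refl ← addr-unique u ay (lift bS)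
      = x∈S , y∈S , σx≢σy , a , b , aS , bS , best-in-S
      where
      best-in-S : ∀ y' c → σ y' ≡ σ y → Addr S y' c → lcp a b ⪯ lcp a c
      best-in-S y' c σy'≡σy ac
        with _ ∷ pre ← subst₂ Prefix (lcp-cons i a c) (lcp-cons i a b) (best y' (i ∷ c) σy'≡σy (lift ac))
        = pre

    extend : BMGArc σ S x y → BMGArc σ (node ts) x y
    extend (_ , _ , σx≢σy , a , b , aS , bS , best) =
      addr⇒∈ (lift aS) , addr⇒∈ (lift bS) , σx≢σy , i ∷ a , i ∷ b , lift aS , lift bS , best-in-T
      where
      best-in-T : ∀ y' p → σ y' ≡ σ y → Addr (node ts) y' p → lcp (i ∷ a) (i ∷ b) ⪯ lcp (i ∷ a) p
      best-in-T y' p σy'≡σy ap with lcp-diverge i a p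
      best-in-T y' .(i ∷ c) σy'≡σy (there ac) | inj₁ (c , refl)
        rewrite lcp-cons i a c | lcp-cons i a b = i ∷ best y' c σy'≡σy (child-addr⁻ S∈ts ac)
      ... | inj₂ diverge rewrite diverge = []

  ArcPred : Set₁
  ArcPred = Fin n → Fin n → Set

  card-empty : ∀ {P : ArcPred} → (∀ x y → ¬ P x y) → Card P 0
  card-empty ¬P = [] , [] , refl , λ x y → mk⇔ (λ ()) (λ p → contradiction p (¬P x y))

  card-cong : ∀ {P Q : ArcPred} {k} → Card P k → (∀ x y → P x y ⇔ Q x y) → Card Q k
  card-cong (l , u , len , l⇔P) P⇔Q = l , u , len , λ x y → P⇔Q x y ⇔-∘ l⇔P x y

  card-union : ∀ {P Q : ArcPred} {a b} → Card P a → Card Q b → (∀ x y → P x y → ¬ Q x y) →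
    Card (λ x y → P x y ⊎ Q x y) (a + b)
  card-union {P} {Q} (l , u , len , l⇔P) (l' , u' , len' , l'⇔Q) disjoint =
    l ++ l' , Unique.++⁺ u u' disjointₗ , trans (length-++ l) (cong₂ _+_ len len') ,
    λ x y → mk⇔ (enumerated x y ∘ ∈-++⁻ l) (enumerates x y)
    where
    disjointₗ : Disjoint l l'
    disjointₗ {x , y} (m , m') = disjoint x y (to (l⇔P x y) m) (to (l'⇔Q x y) m')
    enumerated : ∀ x y → ((x , y) ∈ₗ l) ⊎ ((x , y) ∈ₗ l') → P x y ⊎ Q x y
    enumerated x y = Sum.map (to (l⇔P x y)) (to (l'⇔Q x y))
    enumerates : ∀ x y → P x y ⊎ Q x y → (x , y) ∈ₗ (l ++ l')
    enumerates x y (inj₁ p) = ∈-++⁺ˡ (from (l⇔P x y) p)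
    enumerates x y (inj₂ q) = ∈-++⁺ʳ l (from (l'⇔Q x y) q)

  card-dec : ∀ {P : ArcPred} {k} → Card P k → ∀ x y → Dec (P x y)
  card-dec (l , _ , _ , l⇔P) x y = Dec.map (l⇔P x y) ((x , y) ∈ₗ? l)
    where open DecMembership (≡-dec _≟ᶠ_ _≟ᶠ_) using () renaming (_∈?_ to _∈ₗ?_)

  card-≢-trans : ∀ {H₀ H₁ H₂ : Digraph n} {a b} →
    Card (λ x y → H₀ x y ≢ H₁ x y) a → Card (λ x y → H₁ x y ≢ H₂ x y) b →
    (∀ x y → H₀ x y ≢ H₁ x y → H₁ x y ≡ H₂ x y) →
    Card (λ x y → H₀ x y ≢ H₂ x y) (a + b)
  card-≢-trans {H₀} {H₁} {H₂} card₀₁ card₁₂ kept =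
    card-cong (card-union card₀₁ card₁₂ (λ x y ne₀₁ ne₁₂ → ne₁₂ (kept x y ne₀₁)))
              (λ x y → mk⇔ (changed-once x y) (changed-by-one x y))
    where
    changed-once : ∀ x y → H₀ x y ≢ H₁ x y ⊎ H₁ x y ≢ H₂ x y → H₀ x y ≢ H₂ x y
    changed-once x y (inj₁ ne₀₁) e₀₂ = ne₀₁ (trans e₀₂ (sym (kept x y ne₀₁)))
    changed-once x y (inj₂ ne₁₂) e₀₂ with H₀ x y ≟ᵇ H₁ x y
    ... | yes e₀₁ = ne₁₂ (trans (sym e₀₁) e₀₂)
    ... | no ne₀₁ = ne₁₂ (kept x y ne₀₁)
    changed-by-one : ∀ x y → H₀ x y ≢ H₂ x y → H₀ x y ≢ H₁ x y ⊎ H₁ x y ≢ H₂ x y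
    changed-by-one x y ne₀₂ with H₀ x y ≟ᵇ H₁ x y
    ... | yes e₀₁ = inj₂ (ne₀₂ ∘ trans e₀₁)
    ... | no ne₀₁ = inj₁ ne₀₁

  symDiff-changed : ∀ {G G' : Digraph n} {F : ArcPred} → SymDiffWith G F G' →
    ∀ {x y} → Dec (F x y) → G x y ≢ G' x y ⇔ F x y
  symDiff-changed {G} {G'} {F} sd {x} {y} F? = mk⇔ edited changes
    where
    edited : G x y ≢ G' x y → F x y
    edited ne = decidable-stable F? λ ¬f → ne (sym (proj₂ (sd x y) ¬f))
    changes : F x y → G x y ≢ G' x y
    changes f e = not-¬ refl (trans e (proj₁ (sd x y) f))

  TreeOn : Tree n → Subset n → Set
  TreeOn S W = Phylo S × Unique (leaves S) × LeafSet S W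

  inTrees⇒treeOn : ∀ {W 𝒲 T} → InTrees W 𝒲 T → TreeOn T W
  inTrees⇒treeOn (phylo , u , leafSet , _) = phylo , u , leafSet

  elements : Subset n → List (Fin n)
  elements B = filter (_∈? B) (allFin n)

  ∈-elements : ∀ B x → x ∈ₗ elements B ⇔ x ∈ B
  ∈-elements B x = mk⇔ (proj₂ ∘ ∈-filter⁻ (_∈? B) {xs = allFin n}) (∈-filter⁺ (_∈? B) (∈-allFin x))

  -- A star on the list [] is junk; it is only used for nonempty lists.
  star : List (Fin n) → Tree n
  star []              = node []
  star (x ∷ [])        = leaf x
  star xs@(_ ∷ _ ∷ _)  = node (map Tree.leaf xs)

  leaves-star : ∀ xs → leaves (star xs) ≡ xs
  leaves-star []              = refl
  leaves-star (x ∷ [])        = refl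
  leaves-star xs@(_ ∷ _ ∷ _)  = leavesL-map xs
    where
    leavesL-map : ∀ xs → leavesL (map Tree.leaf xs) ≡ xs
    leavesL-map []       = refl
    leavesL-map (x ∷ xs) = cong (x ∷_) (leavesL-map xs)

  phylo-star : ∀ {x} xs → x ∈ₗ xs → Phylo (star xs)
  phylo-star (x ∷ [])          _ = leaf x
  phylo-star xs@(_ ∷ _ ∷ _)    _ = node (s≤s (s≤s z≤n)) (all-leaves xs)
    where
    all-leaves : ∀ xs → All Phylo (map Tree.leaf xs)
    all-leaves []       = []
    all-leaves (x ∷ xs) = leaf x ∷ all-leaves xs

  starOn : Subset n → Tree n
  starOn B = star (elements B)

  starOn-treeOn : ∀ B → Nonempty B → TreeOn (starOn B) B
  starOn-treeOn B (x , x∈B) rewrite leaves-star (elements B) =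
    phylo-star (elements B) (from (∈-elements B x) x∈B) ,
    Unique.filter⁺ (_∈? B) (Unique.allFin⁺ n) ,
    ∈-elements B

  ∈-⋃⁺ : ∀ {𝒱 : List (Subset n)} {B x} → B ∈ₗ 𝒱 → x ∈ B → x ∈ ⋃ 𝒱
  ∈-⋃⁺ (here refl) x∈B = x∈p∪q⁺ (inj₁ x∈B)
  ∈-⋃⁺ (there B∈𝒱) x∈B = x∈p∪q⁺ (inj₂ (∈-⋃⁺ B∈𝒱 x∈B))

  ∈-⋃⁻ : ∀ 𝒱 {x} → x ∈ ⋃ 𝒱 → Σ[ B ∈ Subset n ] (B ∈ₗ 𝒱 × x ∈ B)
  ∈-⋃⁻ []      x∈⊥ = contradiction x∈⊥ ∉⊥
  ∈-⋃⁻ (B ∷ 𝒱) x∈⋃ with x∈p∪q⁻ B (⋃ 𝒱) x∈⋃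
  ... | inj₁ x∈B = B , here refl , x∈B
  ... | inj₂ x∈⋃𝒱 = let B' , B'∈𝒱 , x∈B' = ∈-⋃⁻ 𝒱 x∈⋃𝒱 in B' , there B'∈𝒱 , x∈B'

  ∈-leavesL⇔∈-⋃ : ∀ {ts 𝒱} → Pointwise TreeOn ts 𝒱 → ∀ x → x ∈ₗ leavesL ts ⇔ x ∈ ⋃ 𝒱
  ∈-leavesL⇔∈-⋃ [] x = mk⇔ (λ ()) (λ x∈⊥ → contradiction x∈⊥ ∉⊥)
  ∈-leavesL⇔∈-⋃ {t ∷ _} {B ∷ 𝒱} ((_ , _ , t-on-B) ∷ ts-on-𝒱) x = mk⇔
    (x∈p∪q⁺ ∘ Sum.map (to (t-on-B x)) (to (∈-leavesL⇔∈-⋃ ts-on-𝒱 x)) ∘ ∈-++⁻ (leaves t))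
    ([ ∈-++⁺ˡ ∘ from (t-on-B x) , ∈-++⁺ʳ (leaves t) ∘ from (∈-leavesL⇔∈-⋃ ts-on-𝒱 x) ]′ ∘ x∈p∪q⁻ B (⋃ 𝒱))

  unique-leavesL : ∀ {ts 𝒱} → Pointwise TreeOn ts 𝒱 → AllPairs (λ A B → Empty (A ∩ B)) 𝒱 →
    Unique (leavesL ts)
  unique-leavesL [] [] = []
  unique-leavesL {t ∷ ts} {B ∷ 𝒱} ((_ , u , t-on-B) ∷ ts-on-𝒱) (B-disjoint ∷ disjoint) =
    Unique.++⁺ u (unique-leavesL ts-on-𝒱 disjoint) separate
    where
    separate : Disjoint (leaves t) (leavesL ts)
    separate {x} (x∈t , x∈ts) with B' , B'∈𝒱 , x∈B' ← ∈-⋃⁻ 𝒱 (to (∈-leavesL⇔∈-⋃ ts-on-𝒱 x) x∈ts) =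
      All.lookup B-disjoint B'∈𝒱 (x , x∈p∩q⁺ (to (t-on-B x) x∈t , x∈B'))

  rootBlocks : ∀ {ts 𝒱} → Pointwise TreeOn ts 𝒱 → RootBlocks (node ts) 𝒱
  rootBlocks ts-on-𝒱 = blocks-of-children ts-on-𝒱 , children-of-blocks ts-on-𝒱
    where
    blocks-of-children : ∀ {ts 𝒱} → Pointwise TreeOn ts 𝒱 →
      ∀ t → t ∈ₗ ts → Σ[ B ∈ Subset n ] (B ∈ₗ 𝒱 × LeafSet t B)
    blocks-of-children ((_ , _ , t-on-B) ∷ _) _ (here refl) = _ , here refl , t-on-B
    blocks-of-children (_ ∷ ts-on-𝒱) t (there t∈ts) =
      let B , B∈𝒱 , t-on-B = blocks-of-children ts-on-𝒱 t t∈ts in B , there B∈𝒱 , t-on-B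
    children-of-blocks : ∀ {ts 𝒱} → Pointwise TreeOn ts 𝒱 →
      ∀ B → B ∈ₗ 𝒱 → Σ[ t ∈ Tree n ] (t ∈ₗ ts × LeafSet t B)
    children-of-blocks ((_ , _ , t-on-B) ∷ _) _ (here refl) = _ , here refl , t-on-B
    children-of-blocks (_ ∷ ts-on-𝒱) B (there B∈𝒱) =
      let t , t∈ts , t-on-B = children-of-blocks ts-on-𝒱 B B∈𝒱 in t , there t∈ts , t-on-B

  inTrees⁺ : ∀ {V' 𝒱 ts} → IsPartition V' 𝒱 → 2 ≤ length 𝒱 → Pointwise TreeOn ts 𝒱 →
    InTrees V' 𝒱 (node ts)
  inTrees⁺ {V'} {𝒱} (_ , disjoint , ⋃𝒱≡V') 2≤|𝒱| ts-on-𝒱 =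
    node (subst (2 ≤_) (sym (Pointwise-length ts-on-𝒱)) 2≤|𝒱|) (all-phylo ts-on-𝒱) ,
    unique-leavesL ts-on-𝒱 disjoint ,
    (λ x → subst (λ W → _ ⇔ x ∈ W) ⋃𝒱≡V' (∈-leavesL⇔∈-⋃ ts-on-𝒱 x)) ,
    rootBlocks ts-on-𝒱
    where
    all-phylo : ∀ {ts 𝒱} → Pointwise TreeOn ts 𝒱 → All Phylo ts
    all-phylo []                       = []
    all-phylo ((phylo , _) ∷ ts-on-𝒱) = phylo ∷ all-phylo ts-on-𝒱

  starsOn-treeOn : ∀ {𝒱} → All Nonempty 𝒱 → Pointwise TreeOn (map starOn 𝒱) 𝒱
  starsOn-treeOn []                 = []
  starsOn-treeOn (B≢∅ ∷ nonempty) = starOn-treeOn _ B≢∅ ∷ starsOn-treeOn nonempty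

  replace-child : ∀ {𝒱 B S} → All Nonempty 𝒱 → B ∈ₗ 𝒱 → TreeOn S B →
    Σ[ ts ∈ List (Tree n) ] (Pointwise TreeOn ts 𝒱 × S ∈ₗ ts)
  replace-child (_ ∷ nonempty) (here refl) S-on-B =
    _ , S-on-B ∷ starsOn-treeOn nonempty , here refl
  replace-child (B'≢∅ ∷ nonempty) (there B∈𝒱) S-on-B =
    let ts , ts-on-𝒱 , S∈ts = replace-child nonempty B∈𝒱 S-on-B
    in  starOn _ ∷ ts , starOn-treeOn _ B'≢∅ ∷ ts-on-𝒱 , there S∈ts

  module _ {σ : Coloring n} where

    Settled : Bool → Subset n → Fin n → Fin n → Set
    Settled b W x y = ∀ S → TreeOn S W → (b ≡ true ⇔ BMGArc σ S x y)

    -- Every tree on a block is a child of the root of some tree in 𝒯(𝒱).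
    settled-block : ∀ {V' 𝒱 B b x y} → IsPartition V' 𝒱 → 2 ≤ length 𝒱 → B ∈ₗ 𝒱 → x ∈ B → y ∈ B →
      (∀ T → InTrees V' 𝒱 T → (b ≡ true ⇔ BMGArc σ T x y)) → Settled b B x y
    settled-block {x = x} {y} P@(nonempty , _) 2≤|𝒱| B∈𝒱 x∈B y∈B agrees S S-on-B@(_ , _ , leafSet)
      with ts , ts-on-𝒱 , S∈ts ← replace-child nonempty B∈𝒱 S-on-B
      with T∈𝒯@(_ , u , _) ← inTrees⁺ P 2≤|𝒱| ts-on-𝒱 =
      bmgArc-child σ S∈ts u (from (leafSet x) x∈B) (from (leafSet y) y∈B) ⇔-∘ agrees (node ts) T∈𝒯

    settled-child : ∀ {V' 𝒱 B b x y} → IsPartition V' 𝒱 → 2 ≤ length 𝒱 → B ∈ₗ 𝒱 → x ∈ B → y ∈ B →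
      Settled b V' x y → Settled b B x y
    settled-child P 2≤|𝒱| B∈𝒱 x∈B y∈B settled =
      settled-block P 2≤|𝒱| B∈𝒱 x∈B y∈B (λ T T∈𝒯 → settled T (inTrees⇒treeOn T∈𝒯))

    edit-settles : ∀ {G V' 𝒱 B x y} → IsPartition V' 𝒱 → 2 ≤ length 𝒱 → InU σ G V' 𝒱 x y →
      B ∈ₗ 𝒱 → x ∈ B → y ∈ B → Settled (not (G x y)) B x y
    edit-settles P 2≤|𝒱| (_ , _ , inUT) B∈𝒱 x∈B y∈B =
      settled-block P 2≤|𝒱| B∈𝒱 x∈B y∈B (λ T T∈𝒯 → xor-not (proj₂ (proj₂ (inUT T T∈𝒯))))

    settled-unedited : ∀ {G V' 𝒱 x y} → IsPartition V' 𝒱 → 2 ≤ length 𝒱 →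
      Settled (G x y) V' x y → ¬ InU σ G V' 𝒱 x y
    settled-unedited {V' = V'} {𝒱} P@(nonempty , _) 2≤|𝒱| settled (_ , _ , inUT) =
      xor-¬⇔ (proj₂ (proj₂ (inUT _ T∈𝒯))) (settled _ (inTrees⇒treeOn T∈𝒯))
      where
      T∈𝒯 : InTrees V' 𝒱 (node (map starOn 𝒱))
      T∈𝒯 = inTrees⁺ P 2≤|𝒱| (starsOn-treeOn nonempty)

    mutual
      run-local : ∀ {H W H' k x y} → Run σ H W H' k → H x y ≢ H' x y → x ∈ W × y ∈ W
      run-local (single _) ne = contradiction refl ne
      run-local {H = G} {x = x} {y} (step {G₁ = G₁} _ (_ , _ , ⋃𝒱≡V') _ card sd rest) ne
        with G x y ≟ᵇ G₁ x y
      ... | no ne₁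
          with x∈V' , y∈V' , _ ← to (symDiff-changed sd (card-dec card x y)) ne₁ = x∈V' , y∈V'
      ... | yes e₁
          with B , B∈𝒱 , x∈B , y∈B ← runAll-local rest (ne ∘ trans e₁) =
          subst (x ∈_) ⋃𝒱≡V' (∈-⋃⁺ B∈𝒱 x∈B) , subst (y ∈_) ⋃𝒱≡V' (∈-⋃⁺ B∈𝒱 y∈B)

      runAll-local : ∀ {H 𝒱 H' k x y} → RunAll σ H 𝒱 H' k → H x y ≢ H' x y →
        Σ[ B ∈ Subset n ] (B ∈ₗ 𝒱 × x ∈ B × y ∈ B)
      runAll-local [] ne = contradiction refl ne
      runAll-local {H} {x = x} {y} (_∷_ {G₁ = H₁} run rest) ne with H x y ≟ᵇ H₁ x y
      ... | no ne₁ = _ , here refl , run-local run ne₁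
      ... | yes e₁ with B , B∈𝒱 , x∈B , y∈B ← runAll-local rest (ne ∘ trans e₁) =
        B , there B∈𝒱 , x∈B , y∈B

    mutual
      run-keeps-settled : ∀ {H W H' k x y} → Run σ H W H' k → Settled (H x y) W x y → H x y ≡ H' x y
      run-keeps-settled (single _) _ = refl
      run-keeps-settled {H = G} {x = x} {y} (step {G₁ = G₁} _ P 2≤|𝒱| _ sd rest) settled =
        trans unedited (runAll-keeps-settled rest λ B∈𝒱 x∈B y∈B →
          subst (λ b → Settled b _ x y) unedited (settled-child P 2≤|𝒱| B∈𝒱 x∈B y∈B settled))
        where
        unedited : G x y ≡ G₁ x y
        unedited = sym (proj₂ (sd x y) (settled-unedited {G = G} P 2≤|𝒱| settled))

      runAll-keeps-settled : ∀ {H 𝒱 H' k x y} → RunAll σ H 𝒱 H' k →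
        (∀ {B} → B ∈ₗ 𝒱 → x ∈ B → y ∈ B → Settled (H x y) B x y) → H x y ≡ H' x y
      runAll-keeps-settled [] _ = refl
      runAll-keeps-settled {H} {x = x} {y} (_∷_ {G₁ = H₁} run rest) settled =
        trans unchanged (runAll-keeps-settled rest λ B∈𝒱 x∈B y∈B →
          subst (λ b → Settled b _ x y) unchanged (settled (there B∈𝒱) x∈B y∈B))
        where
        unchanged : H x y ≡ H₁ x y
        unchanged = decidable-stable (H x y ≟ᵇ H₁ x y) λ ne →
          ne (run-keeps-settled run (uncurry (settled (here refl)) (run-local run ne)))

    mutual
      run-card : ∀ {H W H' k} → Run σ H W H' k → Card (λ x y → H x y ≢ H' x y) k
      run-card (single _) = card-empty (λ _ _ ne → ne refl)
      run-card {H = G} {W = V'}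
               (step {𝒱 = 𝒱} {G₁ = G₁} {G₂ = G₂} _ P@(_ , disjoint , _) 2≤|𝒱| card sd rest) =
        card-≢-trans (card-cong card (λ x y → ⇔-sym (edited⇔changed x y)))
                     (runAll-card rest disjoint)
                     edit-kept
        where
        edited⇔changed : ∀ x y → G x y ≢ G₁ x y ⇔ InU σ G V' 𝒱 x y
        edited⇔changed x y = symDiff-changed sd (card-dec card x y)
        edit-kept : ∀ x y → G x y ≢ G₁ x y → G₁ x y ≡ G₂ x y
        edit-kept x y ne = runAll-keeps-settled rest λ B∈𝒱 x∈B y∈B →
          subst (λ b → Settled b _ x y) (sym (proj₁ (sd x y) u))
                (edit-settles {G = G} P 2≤|𝒱| u B∈𝒱 x∈B y∈B)
          where
          u : InU σ G V' 𝒱 x y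
          u = to (edited⇔changed x y) ne

      runAll-card : ∀ {H 𝒱 H' k} → RunAll σ H 𝒱 H' k → AllPairs (λ A B → Empty (A ∩ B)) 𝒱 →
        Card (λ x y → H x y ≢ H' x y) k
      runAll-card [] [] = card-empty (λ _ _ ne → ne refl)
      runAll-card {H} (_∷_ {G₁ = H₁} {G₂ = H₂} run rest) (B-disjoint ∷ disjoint) =
        card-≢-trans (run-card run) (runAll-card rest disjoint) untouched-later
        where
        untouched-later : ∀ x y → H x y ≢ H₁ x y → H₁ x y ≡ H₂ x y
        untouched-later x y ne = decidable-stable (H₁ x y ≟ᵇ H₂ x y) λ ne' →
          let x∈B , _ = run-local run ne
              B' , B'∈𝒱 , x∈B' , _ = runAll-local rest ne'
          in  All.lookup B-disjoint B'∈𝒱 (x , x∈p∩q⁺ (x∈B , x∈B'))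

corollary2 : ∀ {n} (G : Digraph n) (σ : Coloring n) →
    Loopless G → Proper G σ → 1 ≤ n →
    ∀ (G* : Digraph n) (k : ℕ) → Run σ G ⊤ G* k →
    Card (λ x y → G x y ≢ G* x y) k
corollary2 G σ _ _ _ G* k run = run-card run
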